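{- Let $G=(V,E)$ be a finite graph with $n=|V|\ge 1$. Then the number $\sigma(G)$ of successive vertex orderings of $G$ satisfies $\sigma(G)=n!\,P_G(-1)$; equivalently, $P_G(-1)$ equals the probability that a uniformly random linear ordering of $V$ is successive.
   Context: A linear ordering of $V$ is a bijection $\pi:V\to\{1,\dots,n\}$; it is successive if every vertex $v$ with $\pi(v)>1$ has a neighbour $u$ with $\pi(u)<\pi(v)$. For $I\subseteq V$ let $N(I)$ be the set of vertices adjacent to some vertex of $I$ and $a(I)=n-|I|-|N(I)|$. For independent sets $I$ (no two vertices adjacent) define $b(\varnothing)=1$ and $b(I)=\frac{1}{n-a(I)}\sum_{v\in I}b(I\setminus\{v\})$ for $I\ne\varnothing$, and $w(I)=\frac{a(I)}{n}b(I)$. The successive ordering polynomial is $P_G(x)=\sum_{I\ \text{independent}} w(I)\,x^{|I|}$. -}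

module Defs where

open import Data.Bool using (Bool; true; false; _∧_; _∨_; not; if_then_else_)
open import Data.Nat using (ℕ; zero; suc; _∸_; _<ᵇ_; _≡ᵇ_)
open import Data.Fin using (Fin; toℕ; _≟_)
open import Data.List using (List; []; _∷_; map; concatMap; foldr; allFin; filterᵇ; length)
open import Data.Bool.ListAction using (all; any)
open import Data.Vec using (Vec; []; _∷_; lookup)
open import Data.Integer using (+_)
open import Data.Rational using (ℚ; _+_; _*_; _/_; 0ℚ; 1ℚ)
open import Relation.Binary.PropositionalEquality using (_≡_)
open import Relation.Nullary.Decidable using (⌊_⌋)

record Graph (n : ℕ) : Set where
  field
    adj   : Fin n → Fin n → Bool
    sym   : ∀ u v → adj u v ≡ adj v u
    irrefl : ∀ v → adj v v ≡ false
open Graph public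

-- A linear ordering π : V → {1,…,n} is represented as a function
-- Fin n → Fin n (shifting values by one: position 1 ↦ 0), stored as a
-- vector so that all of them can be enumerated.

allVecs : (m k : ℕ) → List (Vec (Fin k) m)
allVecs zero    k = [] ∷ []
allVecs (suc m) k = concatMap (λ x → map (x ∷_) (allVecs m k)) (allFin k)

-- π is a bijection (for Fin n → Fin n, injectivity suffices)
isBijection : ∀ {n} → Vec (Fin n) n → Bool
isBijection {n} π =
  all (λ u → all (λ v → not ⌊ lookup π u ≟ lookup π v ⌋ ∨ ⌊ u ≟ v ⌋) (allFin n)) (allFin n)

isSuccessive : ∀ {n} → Graph n → Vec (Fin n) n → Bool
isSuccessive {n} G π =
  all (λ v → (toℕ (lookup π v) ≡ᵇ 0)
             ∨ any (λ u → adj G u v ∧ (toℕ (lookup π u) <ᵇ toℕ (lookup π v))) (allFin n))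
      (allFin n)

linearOrderings : (n : ℕ) → List (Vec (Fin n) n)
linearOrderings n = filterᵇ isBijection (allVecs n n)

σ : ∀ {n} → Graph n → ℕ
σ {n} G = length (filterᵇ (isSuccessive G) (linearOrderings n))

Subset : ℕ → Set
Subset n = Vec Bool n

allSubsets : (n : ℕ) → List (Subset n)
allSubsets zero    = [] ∷ []
allSubsets (suc n) = concatMap (λ b → map (b ∷_) (allSubsets n)) (true ∷ false ∷ [])

_∈ˢ_ : ∀ {n} → Fin n → Subset n → Bool
v ∈ˢ I = lookup I v

countV : ∀ {n} → (Fin n → Bool) → ℕ
countV {n} p = length (filterᵇ p (allFin n))

card : ∀ {n} → Subset n → ℕ
card I = countV (λ v → v ∈ˢ I)

inN : ∀ {n} → Graph n → Subset n → Fin n → Bool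
inN {n} G I v = any (λ u → (u ∈ˢ I) ∧ adj G u v) (allFin n)

cardN : ∀ {n} → Graph n → Subset n → ℕ
cardN G I = countV (inN G I)

a : ∀ {n} → Graph n → Subset n → ℕ
a {n} G I = n ∸ card I ∸ cardN G I

isIndependent : ∀ {n} → Graph n → Subset n → Bool
isIndependent {n} G I =
  all (λ u → all (λ v → not ((u ∈ˢ I) ∧ (v ∈ˢ I) ∧ adj G u v)) (allFin n)) (allFin n)

remove : ∀ {n} → Subset n → Fin n → Subset n
remove []      ()
remove (x ∷ I) Fin.zero    = false ∷ I
remove (x ∷ I) (Fin.suc v) = x ∷ remove I v

-- 1/k as a rational, for k ≥ 1 (only ever applied to k ≥ 1 below;
-- the value at k = 0 is an irrelevant junk value)
inv : ℕ → ℚ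
inv zero    = 0ℚ
inv (suc k) = + 1 / suc k

ℕ→ℚ : ℕ → ℚ
ℕ→ℚ k = + k / 1

sumℚ : List ℚ → ℚ
sumℚ = foldr _+_ 0ℚ

-- b, defined by recursion on a fuel parameter equal to |I|:
-- b(∅) = 1,  b(I) = (1/(n - a(I))) Σ_{v∈I} b(I \ {v}).
-- For nonempty independent I, n - a(I) = |I| + |N(I)| ≥ 1.
bAux : ∀ {n} → Graph n → ℕ → Subset n → ℚ
bAux G zero    I = 1ℚ
bAux {n} G (suc k) I =
  inv (n ∸ a G I) * sumℚ (map (λ v → bAux G k (remove I v)) (filterᵇ (λ v → v ∈ˢ I) (allFin n)))

b : ∀ {n} → Graph n → Subset n → ℚ
b G I = bAux G (card I) I

w : ∀ {n} → Graph n → Subset n → ℚ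
w {n} G I = (ℕ→ℚ (a G I) * inv n) * b G I

negOnePow : ℕ → ℚ
negOnePow zero    = 1ℚ
negOnePow (suc k) = Data.Rational.- negOnePow k

P-at-minus1 : ∀ {n} → Graph n → ℚ
P-at-minus1 {n} G =
  sumℚ (map (λ I → w G I * negOnePow (card I)) (filterᵇ (isIndependent G) (allSubsets n)))

module Submission where

-- A vertex v is a defect of an ordering π if it is not first and has no earlier
-- neighbour, so π is successive iff it has no defect, and inclusion–exclusion gives
-- σ(G) = Σ_I (-1)^|I| N(I), where N(I) counts the orderings in which every vertex of
-- I is a defect. Two adjacent vertices cannot both be defects (the later one has an
-- earlier neighbour), so N(I) = 0 unless I is independent. For independent I, read π
-- as the sequence τ = π⁻¹: all of I are defects iff τ does not start in I and every
-- vertex of I comes before all of its neighbours. Splitting off the first vertex, the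
-- arrangements of an m-set R ⊇ I ∪ N(I) with the latter property number m! b(I): the
-- first vertex is either some x ∈ I, leaving I ∖ {x}, or one of the
-- m − |I| − |N(I)| vertices outside I ∪ N(I), and (|I| + |N(I)|) b(I) =
-- Σ_{x∈I} b(I ∖ {x}) is the recursion defining b. The first vertex of τ has a(I)
-- choices, hence N(I) = a(I) (n−1)! b(I) = n! w(I).

open import Defs hiding (sym)
open import Data.Nat using (ℕ; _≤_; _!)
open import Data.Rational using (_*_)
open import Relation.Binary.PropositionalEquality using (_≡_)

open import Algebra.Bundles using (CommutativeMonoid)
import Algebra.Properties.CommutativeSemigroup as CommSemigroupProperties
open import Data.Bool using (Bool; true; false; _∧_; _∨_; not; if_then_else_)
import Data.Bool.Properties as BP
open import Data.Bool.ListAction using (and; all; any)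
open import Data.Fin as F using (Fin; toℕ; _≟_)
import Data.Fin.Properties as FP
import Data.Integer as Z
import Data.Integer.Properties as ZP
open import Data.List using (List; []; _∷_; map; concatMap; filterᵇ; length; allFin; tabulate; _++_)
import Data.List.Properties as LP
import Data.List.Relation.Unary.All as All
import Data.List.Relation.Unary.All.Properties as AllP
import Data.List.Relation.Unary.Any.Properties as AnyP
import Data.Nat as N
open import Data.Nat using (_≡ᵇ_; _<ᵇ_)
import Data.Nat.Coprimality as C
import Data.Nat.Properties as NP
open import Data.Product using (∃; _×_; _,_; proj₁; proj₂; map₁; map₂)
open import Data.Sum using (_⊎_; inj₁; inj₂)
open import Data.Rational as Q using (ℚ; 0ℚ; 1ℚ; mkℚ; _+_; -_)
import Data.Rational.Properties as QP
open import Data.Rational.Solver using (module +-*-Solver)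
open import Data.Vec as V using (Vec; []; _∷_; lookup)
import Data.Vec.Properties as VP
open import Function using (_∘_; id; case_of_; _⇔_; mk⇔; Equivalence)
open import Function.Definitions using (Injective)
open import Relation.Binary.Definitions using (DecidableEquality)
open import Relation.Binary.PropositionalEquality
  using (_≢_; refl; sym; trans; cong; cong₂; subst; subst₂; module ≡-Reasoning)
open import Relation.Nullary using (¬_; Dec; yes; no; contradiction)
open import Relation.Nullary.Decidable using (⌊_⌋; ⌊⌋-map′; isYes≗does)

open ≡-Reasoning
open Equivalence using (to; from)
open +-*-Solver using (solve; _:*_; _:=_)
module ℚ+ = CommSemigroupProperties (CommutativeMonoid.commutativeSemigroup QP.+-0-commutativeMonoid)
module ℚ* = CommSemigroupProperties (CommutativeMonoid.commutativeSemigroup QP.*-1-commutativeMonoid)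
module 𝔹∧ = CommSemigroupProperties (CommutativeMonoid.commutativeSemigroup BP.∧-commutativeMonoid)

private variable A B : Set

𝟙 : Bool → ℚ
𝟙 true  = 1ℚ
𝟙 false = 0ℚ

∑ : List A → (A → ℚ) → ℚ
∑ []       f = 0ℚ
∑ (x ∷ xs) f = f x + ∑ xs f

syntax ∑ xs (λ x → e) = ∑[ x ∈ xs ] e

𝟙-∧ : ∀ a b → 𝟙 (a ∧ b) ≡ 𝟙 a * 𝟙 b
𝟙-∧ true  b = sym (QP.*-identityˡ (𝟙 b))
𝟙-∧ false b = sym (QP.*-zeroˡ (𝟙 b))

∑-cong : ∀ (xs : List A) {f g : A → ℚ} → (∀ x → f x ≡ g x) → ∑ xs f ≡ ∑ xs g
∑-cong []       f≗g = refl
∑-cong (x ∷ xs) f≗g = cong₂ _+_ (f≗g x) (∑-cong xs f≗g)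

∑-zero : ∀ (xs : List A) → ∑[ x ∈ xs ] 0ℚ ≡ 0ℚ
∑-zero []       = refl
∑-zero (x ∷ xs) = trans (QP.+-identityˡ _) (∑-zero xs)

∑-distrib-+ : ∀ (xs : List A) (f g : A → ℚ) → ∑[ x ∈ xs ] (f x + g x) ≡ ∑ xs f + ∑ xs g
∑-distrib-+ []       f g = sym (QP.+-identityˡ 0ℚ)
∑-distrib-+ (x ∷ xs) f g =
  trans (cong ((f x + g x) +_) (∑-distrib-+ xs f g)) (ℚ+.interchange (f x) (g x) (∑ xs f) (∑ xs g))

*-distribˡ-∑ : ∀ c (xs : List A) (f : A → ℚ) → c * ∑ xs f ≡ ∑[ x ∈ xs ] (c * f x)
*-distribˡ-∑ c []       f = QP.*-zeroʳ c
*-distribˡ-∑ c (x ∷ xs) f = trans (QP.*-distribˡ-+ c (f x) _) (cong (c * f x +_) (*-distribˡ-∑ c xs f))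

*-distribʳ-∑ : ∀ c (xs : List A) (f : A → ℚ) → ∑ xs f * c ≡ ∑[ x ∈ xs ] (f x * c)
*-distribʳ-∑ c xs f = trans (QP.*-comm _ c) (trans (*-distribˡ-∑ c xs f) (∑-cong xs (λ x → QP.*-comm c (f x))))

neg-distrib-∑ : ∀ (xs : List A) (f : A → ℚ) → - ∑ xs f ≡ ∑[ x ∈ xs ] (- f x)
neg-distrib-∑ []       f = refl
neg-distrib-∑ (x ∷ xs) f = trans (QP.neg-distrib-+ (f x) _) (cong (- f x +_) (neg-distrib-∑ xs f))

∑-++ : ∀ (xs ys : List A) (f : A → ℚ) → ∑ (xs ++ ys) f ≡ ∑ xs f + ∑ ys f
∑-++ []       ys f = sym (QP.+-identityˡ _)
∑-++ (x ∷ xs) ys f = trans (cong (f x +_) (∑-++ xs ys f)) (sym (QP.+-assoc (f x) _ _))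

∑-map : (g : B → A) (xs : List B) (f : A → ℚ) → ∑ (map g xs) f ≡ ∑ xs (f ∘ g)
∑-map g []       f = refl
∑-map g (x ∷ xs) f = cong (f (g x) +_) (∑-map g xs f)

∑-concatMap : (g : B → List A) (xs : List B) (f : A → ℚ) → ∑ (concatMap g xs) f ≡ ∑[ x ∈ xs ] ∑ (g x) f
∑-concatMap g []       f = refl
∑-concatMap g (x ∷ xs) f = trans (∑-++ (g x) _ f) (cong (∑ (g x) f +_) (∑-concatMap g xs f))

∑-filterᵇ : ∀ (p : A → Bool) (xs : List A) (f : A → ℚ) → ∑ (filterᵇ p xs) f ≡ ∑[ x ∈ xs ] (𝟙 (p x) * f x)
∑-filterᵇ p []       f = refl
∑-filterᵇ p (x ∷ xs) f with p x
... | true  = cong₂ _+_ (sym (QP.*-identityˡ (f x))) (∑-filterᵇ p xs f)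
... | false = trans (∑-filterᵇ p xs f) (sym (trans (cong (_+ _) (QP.*-zeroˡ (f x))) (QP.+-identityˡ _)))

∑-comm : (xs : List A) (ys : List B) (f : A → B → ℚ) → ∑[ x ∈ xs ] ∑ ys (f x) ≡ ∑[ y ∈ ys ] ∑[ x ∈ xs ] f x y
∑-comm []       ys f = sym (∑-zero ys)
∑-comm (x ∷ xs) ys f = trans (cong (∑ ys (f x) +_) (∑-comm xs ys f)) (sym (∑-distrib-+ ys (f x) _))

sumℚ-map : ∀ (f : A → ℚ) (xs : List A) → sumℚ (map f xs) ≡ ∑ xs f
sumℚ-map f []       = refl
sumℚ-map f (x ∷ xs) = cong (f x +_) (sumℚ-map f xs)

∑-tabulate : ∀ {n} (g : Fin n → A) (f : A → ℚ) → ∑ (tabulate g) f ≡ ∑ (allFin n) (f ∘ g)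
∑-tabulate {n = N.zero}  g f = refl
∑-tabulate {n = N.suc n} g f =
  cong (f (g F.zero) +_) (trans (∑-tabulate (g ∘ F.suc) f) (sym (∑-tabulate F.suc (f ∘ g))))

∑-allFin-suc : ∀ {n} (f : Fin (N.suc n) → ℚ) → ∑ (allFin (N.suc n)) f ≡ f F.zero + ∑ (allFin n) (f ∘ F.suc)
∑-allFin-suc f = cong (f F.zero +_) (∑-tabulate F.suc f)

⌊suc≟suc⌋ : ∀ {k} (x y : Fin k) → ⌊ F.suc x ≟ F.suc y ⌋ ≡ ⌊ x ≟ y ⌋
⌊suc≟suc⌋ x y = ⌊⌋-map′ _ _ (x ≟ y)

∑-δ : ∀ {k} (y : Fin k) (f : Fin k → ℚ) → ∑[ x ∈ allFin k ] (𝟙 ⌊ x ≟ y ⌋ * f x) ≡ f y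
∑-δ {N.suc k} F.zero f = begin
  ∑[ x ∈ allFin (N.suc k) ] (𝟙 ⌊ x ≟ F.zero ⌋ * f x)   ≡⟨ ∑-allFin-suc (λ x → 𝟙 ⌊ x ≟ F.zero ⌋ * f x) ⟩
  1ℚ * f F.zero + ∑[ x ∈ allFin k ] (0ℚ * f (F.suc x))
    ≡⟨ cong₂ _+_ (QP.*-identityˡ (f F.zero)) (∑-cong (allFin k) (λ x → QP.*-zeroˡ (f (F.suc x)))) ⟩
  f F.zero + ∑[ x ∈ allFin k ] 0ℚ                     ≡⟨ cong (f F.zero +_) (∑-zero (allFin k)) ⟩
  f F.zero + 0ℚ                                        ≡⟨ QP.+-identityʳ _ ⟩
  f F.zero                                             ∎
∑-δ {N.suc k} (F.suc y) f = begin
  ∑[ x ∈ allFin (N.suc k) ] (𝟙 ⌊ x ≟ F.suc y ⌋ * f x)  ≡⟨ ∑-allFin-suc (λ x → 𝟙 ⌊ x ≟ F.suc y ⌋ * f x) ⟩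
  0ℚ * f F.zero + ∑[ x ∈ allFin k ] (𝟙 ⌊ F.suc x ≟ F.suc y ⌋ * f (F.suc x))
    ≡⟨ cong₂ _+_ (QP.*-zeroˡ (f F.zero)) (∑-cong (allFin k) (λ x → cong (λ d → 𝟙 d * f (F.suc x)) (⌊suc≟suc⌋ x y))) ⟩
  0ℚ + ∑[ x ∈ allFin k ] (𝟙 ⌊ x ≟ y ⌋ * f (F.suc x))   ≡⟨ QP.+-identityˡ _ ⟩
  ∑[ x ∈ allFin k ] (𝟙 ⌊ x ≟ y ⌋ * f (F.suc x))        ≡⟨ ∑-δ y (f ∘ F.suc) ⟩
  f (F.suc y)                                           ∎

∑-allVecs-suc : ∀ {m k} (F : Vec (Fin k) (N.suc m) → ℚ) →
                ∑ (allVecs (N.suc m) k) F ≡ ∑[ x ∈ allFin k ] ∑[ τ ∈ allVecs m k ] F (x ∷ τ)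
∑-allVecs-suc {m} {k} F = trans (∑-concatMap (λ x → map (x ∷_) (allVecs m k)) (allFin k) F)
                                (∑-cong (allFin k) (λ x → ∑-map (x ∷_) (allVecs m k) F))

_≟ⱽ_ : ∀ {k m} → DecidableEquality (Vec (Fin k) m)
_≟ⱽ_ = VP.≡-dec _≟_

⌊∷≟ⱽ∷⌋ : ∀ {k m} (x y : Fin k) (ρ π : Vec (Fin k) m) → ⌊ (x ∷ ρ) ≟ⱽ (y ∷ π) ⌋ ≡ ⌊ x ≟ y ⌋ ∧ ⌊ ρ ≟ⱽ π ⌋
⌊∷≟ⱽ∷⌋ x y ρ π =
  trans (isYes≗does ((x ∷ ρ) ≟ⱽ (y ∷ π))) (sym (cong₂ _∧_ (isYes≗does (x ≟ y)) (isYes≗does (ρ ≟ⱽ π))))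

∑-allVecs-δ : ∀ {k} m (h : Vec (Fin k) m → ℚ) π → ∑[ ρ ∈ allVecs m k ] (𝟙 ⌊ ρ ≟ⱽ π ⌋ * h ρ) ≡ h π
∑-allVecs-δ N.zero h [] = trans (QP.+-identityʳ _) (QP.*-identityˡ (h []))
∑-allVecs-δ {k} (N.suc m) h (y ∷ π) = begin
  ∑[ ρ ∈ allVecs (N.suc m) k ] (𝟙 ⌊ ρ ≟ⱽ (y ∷ π) ⌋ * h ρ)       ≡⟨ ∑-allVecs-suc (λ ρ → 𝟙 ⌊ ρ ≟ⱽ (y ∷ π) ⌋ * h ρ) ⟩
  ∑[ x ∈ allFin k ] ∑[ ρ ∈ allVecs m k ] (𝟙 ⌊ (x ∷ ρ) ≟ⱽ (y ∷ π) ⌋ * h (x ∷ ρ))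
    ≡⟨ ∑-cong (allFin k) (λ x → ∑-cong (allVecs m k) (split x)) ⟩
  ∑[ x ∈ allFin k ] ∑[ ρ ∈ allVecs m k ] (𝟙 ⌊ x ≟ y ⌋ * (𝟙 ⌊ ρ ≟ⱽ π ⌋ * h (x ∷ ρ)))
    ≡⟨ ∑-cong (allFin k) (λ x → *-distribˡ-∑ (𝟙 ⌊ x ≟ y ⌋) (allVecs m k) _) ⟨
  ∑[ x ∈ allFin k ] (𝟙 ⌊ x ≟ y ⌋ * ∑[ ρ ∈ allVecs m k ] (𝟙 ⌊ ρ ≟ⱽ π ⌋ * h (x ∷ ρ)))
    ≡⟨ ∑-cong (allFin k) (λ x → cong (𝟙 ⌊ x ≟ y ⌋ *_) (∑-allVecs-δ m (h ∘ (x ∷_)) π)) ⟩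
  ∑[ x ∈ allFin k ] (𝟙 ⌊ x ≟ y ⌋ * h (x ∷ π))                   ≡⟨ ∑-δ y (λ x → h (x ∷ π)) ⟩
  h (y ∷ π)                                                    ∎
  where
  split : ∀ x ρ → 𝟙 ⌊ (x ∷ ρ) ≟ⱽ (y ∷ π) ⌋ * h (x ∷ ρ) ≡ 𝟙 ⌊ x ≟ y ⌋ * (𝟙 ⌊ ρ ≟ⱽ π ⌋ * h (x ∷ ρ))
  split x ρ = trans (cong (_* h (x ∷ ρ)) (trans (cong 𝟙 (⌊∷≟ⱽ∷⌋ x y ρ π)) (𝟙-∧ ⌊ x ≟ y ⌋ ⌊ ρ ≟ⱽ π ⌋)))
                    (QP.*-assoc (𝟙 ⌊ x ≟ y ⌋) (𝟙 ⌊ ρ ≟ⱽ π ⌋) (h (x ∷ ρ)))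

ℕ→ℚ≡mkℚ : ∀ k → ℕ→ℚ k ≡ mkℚ (Z.+ k) 0 (C.sym (C.1-coprimeTo k))
ℕ→ℚ≡mkℚ k = QP.normalize-coprime (C.sym (C.1-coprimeTo k))

ℕ→ℚ-+ : ∀ j k → ℕ→ℚ (j N.+ k) ≡ ℕ→ℚ j + ℕ→ℚ k
ℕ→ℚ-+ j k = begin
  Z.+ (j N.+ k) Q./ 1                          ≡⟨ cong (Q._/ 1) (ZP.pos-+ j k) ⟩
  (Z.+ j Z.+ Z.+ k) Q./ 1
    ≡⟨ cong (Q._/ 1) (cong₂ Z._+_ (sym (ZP.*-identityʳ (Z.+ j))) (sym (ZP.*-identityʳ (Z.+ k)))) ⟩
  (Z.+ j Z.* Z.+ 1 Z.+ Z.+ k Z.* Z.+ 1) Q./ 1  ≡⟨ cong₂ _+_ (sym (ℕ→ℚ≡mkℚ j)) (sym (ℕ→ℚ≡mkℚ k)) ⟩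
  ℕ→ℚ j + ℕ→ℚ k                                ∎

ℕ→ℚ-* : ∀ j k → ℕ→ℚ (j N.* k) ≡ ℕ→ℚ j * ℕ→ℚ k
ℕ→ℚ-* j k = trans (cong (Q._/ 1) (ZP.pos-* j k)) (cong₂ _*_ (sym (ℕ→ℚ≡mkℚ j)) (sym (ℕ→ℚ≡mkℚ k)))

ℕ→ℚ-injective : ∀ {j k} → ℕ→ℚ j ≡ ℕ→ℚ k → j ≡ k
ℕ→ℚ-injective {j} {k} eq = ZP.+-injective (begin
  Z.+ j        ≡⟨ cong Q.↥_ (ℕ→ℚ≡mkℚ j) ⟨
  Q.↥ ℕ→ℚ j    ≡⟨ cong Q.↥_ eq ⟩
  Q.↥ ℕ→ℚ k    ≡⟨ cong Q.↥_ (ℕ→ℚ≡mkℚ k) ⟩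
  Z.+ k        ∎)

inv-inverseˡ : ∀ k → inv (N.suc k) * ℕ→ℚ (N.suc k) ≡ 1ℚ
inv-inverseˡ k = trans (cong₂ _*_ (QP.normalize-coprime (C.1-coprimeTo (N.suc k))) (ℕ→ℚ≡mkℚ (N.suc k)))
                       (QP.*-inverseˡ (mkℚ (Z.+ N.suc k) 0 (C.sym (C.1-coprimeTo (N.suc k)))))

length-filterᵇ : ∀ (p : A → Bool) (xs : List A) → ℕ→ℚ (length (filterᵇ p xs)) ≡ ∑[ x ∈ xs ] 𝟙 (p x)
length-filterᵇ p []       = refl
length-filterᵇ p (x ∷ xs) with p x
... | true  = trans (ℕ→ℚ-+ 1 (length (filterᵇ p xs))) (cong (1ℚ +_) (length-filterᵇ p xs))
... | false = trans (length-filterᵇ p xs) (sym (QP.+-identityˡ _))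

true⇔true⇒≡ : ∀ {a b} → (a ≡ true ⇔ b ≡ true) → a ≡ b
true⇔true⇒≡ {true}  {true}  _   = refl
true⇔true⇒≡ {false} {false} _   = refl
true⇔true⇒≡ {true}  {false} a⇔b = sym (to a⇔b refl)
true⇔true⇒≡ {false} {true}  a⇔b = from a⇔b refl

≡false⇔≢true : ∀ {a} → a ≡ false ⇔ a ≢ true
≡false⇔≢true {true}  = mk⇔ (λ ()) (λ a≢true → contradiction refl a≢true)
≡false⇔≢true {false} = mk⇔ (λ _ ()) (λ _ → refl)

∧-≡true : ∀ {a b} → a ∧ b ≡ true ⇔ (a ≡ true × b ≡ true)
∧-≡true {a} {b} = mk⇔ (λ e → BP.∧-conicalˡ a b e , BP.∧-conicalʳ a b e) λ { (refl , refl) → refl }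

∨-≡true : ∀ {a b} → a ∨ b ≡ true ⇔ (a ≡ true ⊎ b ≡ true)
∨-≡true {true}  = mk⇔ (λ _ → inj₁ refl) (λ _ → refl)
∨-≡true {false} = mk⇔ inj₂ λ { (inj₁ ()) ; (inj₂ e) → e }

not-≡true : ∀ {a} → not a ≡ true ⇔ a ≡ false
not-≡true {true}  = mk⇔ (λ ()) (λ ())
not-≡true {false} = mk⇔ (λ _ → refl) (λ _ → refl)

implies-≡true : ∀ {a b} → not a ∨ b ≡ true ⇔ (a ≡ true → b ≡ true)
implies-≡true {true}  = mk⇔ (λ e _ → e) (λ f → f refl)
implies-≡true {false} = mk⇔ (λ _ ()) (λ _ → refl)

nand-≡true : ∀ {a b c} → not (a ∧ b ∧ c) ≡ true ⇔ (a ≡ true → b ≡ true → c ≡ false)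
nand-≡true {true}  {true}  = mk⇔ (λ e _ _ → to not-≡true e) (λ f → from not-≡true (f refl refl))
nand-≡true {true}  {false} = mk⇔ (λ _ _ ()) (λ _ → refl)
nand-≡true {false}         = mk⇔ (λ _ ()) (λ _ → refl)

⌊⌋-≡true : ∀ {P : Set} (d : Dec P) → ⌊ d ⌋ ≡ true ⇔ P
⌊⌋-≡true (yes p) = mk⇔ (λ _ → p) (λ _ → refl)
⌊⌋-≡true (no ¬p) = mk⇔ (λ ()) (λ p → contradiction p ¬p)

⌊⌋-≡false : ∀ {P : Set} (d : Dec P) → ¬ P → ⌊ d ⌋ ≡ false
⌊⌋-≡false (yes p) ¬p = contradiction p ¬p
⌊⌋-≡false (no _)  _  = refl

all-allFin : ∀ {n} {p : Fin n → Bool} → all p (allFin n) ≡ true ⇔ (∀ i → p i ≡ true)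
all-allFin {n} {p} = mk⇔
  (λ e i → to BP.T-≡ (AllP.tabulate⁻ (AllP.all⁺ p (allFin n) (from BP.T-≡ e)) i))
  (λ f → to BP.T-≡ (AllP.all⁻ p (AllP.tabulate⁺ (λ i → from BP.T-≡ (f i)))))

any-allFin : ∀ {n} {p : Fin n → Bool} → any p (allFin n) ≡ true ⇔ ∃ λ i → p i ≡ true
any-allFin {n} {p} = mk⇔
  (λ e → map₂ (to BP.T-≡) (AnyP.tabulate⁻ (AnyP.any⁻ p (allFin n) (from BP.T-≡ e))))
  (λ (i , e) → to BP.T-≡ (AnyP.any⁺ p (AnyP.tabulate⁺ i (from BP.T-≡ e))))

all-allFin-suc : ∀ {n} (p : Fin (N.suc n) → Bool) → all p (allFin (N.suc n)) ≡ p F.zero ∧ all (p ∘ F.suc) (allFin n)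
all-allFin-suc p =
  cong (λ bs → p F.zero ∧ and bs) (trans (LP.map-tabulate F.suc p) (sym (LP.map-tabulate id (p ∘ F.suc))))

module _ {A : Set} (_≟ᴬ_ : DecidableEquality A) (xs : List A)
         (∑-δ-xs : ∀ (h : A → ℚ) y → ∑[ x ∈ xs ] (𝟙 ⌊ x ≟ᴬ y ⌋ * h x) ≡ h y) where

  ∑-filterᵇ-involution : ∀ (P : A → Bool) (g : A → A) → (∀ x → P x ≡ true → P (g x) ≡ true) →
                         (∀ x → P x ≡ true → g (g x) ≡ x) → ∀ f → ∑ (filterᵇ P xs) f ≡ ∑ (filterᵇ P xs) (f ∘ g)
  ∑-filterᵇ-involution P g P-g g-g f = sym (begin
    ∑ (filterᵇ P xs) (f ∘ g)                                       ≡⟨ ∑-filterᵇ P xs (f ∘ g) ⟩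
    ∑[ ρ ∈ xs ] (𝟙 (P ρ) * f (g ρ))                                ≡⟨ ∑-cong xs (λ ρ → cong (𝟙 (P ρ) *_) (sym (∑-δ-xs f (g ρ)))) ⟩
    ∑[ ρ ∈ xs ] (𝟙 (P ρ) * ∑[ σ ∈ xs ] (𝟙 ⌊ σ ≟ᴬ g ρ ⌋ * f σ))     ≡⟨ ∑-cong xs (λ ρ → *-distribˡ-∑ (𝟙 (P ρ)) xs _) ⟩
    ∑[ ρ ∈ xs ] ∑[ σ ∈ xs ] (𝟙 (P ρ) * (𝟙 ⌊ σ ≟ᴬ g ρ ⌋ * f σ))     ≡⟨ ∑-comm xs xs _ ⟩
    ∑[ σ ∈ xs ] ∑[ ρ ∈ xs ] (𝟙 (P ρ) * (𝟙 ⌊ σ ≟ᴬ g ρ ⌋ * f σ))     ≡⟨ ∑-cong xs (λ σ → ∑-cong xs (λ ρ → swap ρ σ)) ⟩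
    ∑[ σ ∈ xs ] ∑[ ρ ∈ xs ] (𝟙 ⌊ ρ ≟ᴬ g σ ⌋ * (𝟙 (P σ) * f σ))     ≡⟨ ∑-cong xs (λ σ → ∑-δ-xs (λ _ → 𝟙 (P σ) * f σ) (g σ)) ⟩
    ∑[ σ ∈ xs ] (𝟙 (P σ) * f σ)                                    ≡⟨ ∑-filterᵇ P xs f ⟨
    ∑ (filterᵇ P xs) f                                             ∎)
    where
    g-pairs : ∀ ρ σ → P ρ ≡ true → σ ≡ g ρ → ρ ≡ g σ × P σ ≡ true
    g-pairs ρ σ Pρ refl = sym (g-g ρ Pρ) , P-g ρ Pρ
    paired : ∀ ρ σ → (P ρ ∧ ⌊ σ ≟ᴬ g ρ ⌋) ≡ (⌊ ρ ≟ᴬ g σ ⌋ ∧ P σ)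
    paired ρ σ = true⇔true⇒≡ (mk⇔
      (λ e → let (Pρ , σ≡gρ) = map₂ (to (⌊⌋-≡true (σ ≟ᴬ g ρ))) (to ∧-≡true e)
             in from ∧-≡true (map₁ (from (⌊⌋-≡true (ρ ≟ᴬ g σ))) (g-pairs ρ σ Pρ σ≡gρ)))
      (λ e → let (ρ≡gσ , Pσ) = map₁ (to (⌊⌋-≡true (ρ ≟ᴬ g σ))) (to ∧-≡true e)
                 (σ≡gρ , Pρ) = g-pairs σ ρ Pσ ρ≡gσ
             in from ∧-≡true (Pρ , from (⌊⌋-≡true (σ ≟ᴬ g ρ)) σ≡gρ)))
    swap : ∀ ρ σ → 𝟙 (P ρ) * (𝟙 ⌊ σ ≟ᴬ g ρ ⌋ * f σ) ≡ 𝟙 ⌊ ρ ≟ᴬ g σ ⌋ * (𝟙 (P σ) * f σ)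
    swap ρ σ = begin
      𝟙 (P ρ) * (𝟙 ⌊ σ ≟ᴬ g ρ ⌋ * f σ)   ≡⟨ QP.*-assoc (𝟙 (P ρ)) _ (f σ) ⟨
      (𝟙 (P ρ) * 𝟙 ⌊ σ ≟ᴬ g ρ ⌋) * f σ
        ≡⟨ cong (_* f σ) (trans (sym (𝟙-∧ (P ρ) ⌊ σ ≟ᴬ g ρ ⌋)) (trans (cong 𝟙 (paired ρ σ)) (𝟙-∧ ⌊ ρ ≟ᴬ g σ ⌋ (P σ)))) ⟩
      (𝟙 ⌊ ρ ≟ᴬ g σ ⌋ * 𝟙 (P σ)) * f σ   ≡⟨ QP.*-assoc (𝟙 ⌊ ρ ≟ᴬ g σ ⌋) (𝟙 (P σ)) (f σ) ⟩
      𝟙 ⌊ ρ ≟ᴬ g σ ⌋ * (𝟙 (P σ) * f σ)   ∎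

without : ∀ {n} → (Fin n → Bool) → Fin n → Fin n → Bool
without p x y = p y ∧ not ⌊ y ≟ x ⌋

without-⇔ : ∀ {n} (p : Fin n → Bool) {x y} → without p x y ≡ true ⇔ (p y ≡ true × y ≢ x)
without-⇔ p {x} {y} = mk⇔
  (λ e → let (py , y≢ᵇx) = to ∧-≡true e
         in py , λ y≡x → contradiction (from (⌊⌋-≡true (y ≟ x)) y≡x) (to ≡false⇔≢true (to not-≡true y≢ᵇx)))
  (λ (py , y≢x) → from ∧-≡true (py , from not-≡true (⌊⌋-≡false (y ≟ x) y≢x)))

-- Counts are compared through their indicator sums in ℚ, where pointwise case analysis suffices.
countV-via-∑ : ∀ {n} (p : Fin n → Bool) {k} → ∑[ x ∈ allFin n ] 𝟙 (p x) ≡ ℕ→ℚ k → countV p ≡ k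
countV-via-∑ p e = ℕ→ℚ-injective (trans (length-filterᵇ p (allFin _)) e)

countV-cong : ∀ {n} {p q : Fin n → Bool} → (∀ x → p x ≡ q x) → countV p ≡ countV q
countV-cong {n} {p} {q} p≗q =
  countV-via-∑ p (trans (∑-cong (allFin n) (cong 𝟙 ∘ p≗q)) (sym (length-filterᵇ q (allFin n))))

countV-none : ∀ {n} {p : Fin n → Bool} → (∀ x → p x ≡ false) → countV p ≡ 0
countV-none {n} {p} p≗false = countV-via-∑ p (trans (∑-cong (allFin n) (cong 𝟙 ∘ p≗false)) (∑-zero (allFin n)))

countV-all : ∀ {n} → countV {n} (λ _ → true) ≡ n
countV-all {n} = trans (cong length (LP.filter-all (λ _ → BP.T? true) (All.universal _ (allFin n))))
                       (LP.length-tabulate id)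

countV-without : ∀ {n} (p : Fin n → Bool) {x} → p x ≡ true → countV p ≡ N.suc (countV (without p x))
countV-without {n} p {x} px = countV-via-∑ p (begin
  ∑[ y ∈ allFin n ] 𝟙 (p y)                                  ≡⟨ ∑-cong (allFin n) split ⟩
  ∑[ y ∈ allFin n ] (𝟙 ⌊ y ≟ x ⌋ * 1ℚ + 𝟙 (without p x y))
    ≡⟨ ∑-distrib-+ (allFin n) (λ y → 𝟙 ⌊ y ≟ x ⌋ * 1ℚ) (𝟙 ∘ without p x) ⟩
  ∑[ y ∈ allFin n ] (𝟙 ⌊ y ≟ x ⌋ * 1ℚ) + ∑[ y ∈ allFin n ] 𝟙 (without p x y)
    ≡⟨ cong₂ _+_ (∑-δ x (λ _ → 1ℚ)) (sym (length-filterᵇ (without p x) (allFin n))) ⟩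
  1ℚ + ℕ→ℚ (countV (without p x))                            ≡⟨ ℕ→ℚ-+ 1 (countV (without p x)) ⟨
  ℕ→ℚ (N.suc (countV (without p x)))                         ∎)
  where
  split : ∀ y → 𝟙 (p y) ≡ 𝟙 ⌊ y ≟ x ⌋ * 1ℚ + 𝟙 (without p x y)
  split y with y ≟ x
  ... | yes refl rewrite px = refl
  ... | no  _    = trans (cong 𝟙 (sym (BP.∧-identityʳ (p y)))) (sym (QP.+-identityˡ _))

countV≡0⇒none : ∀ {n} (p : Fin n → Bool) → countV p ≡ 0 → ∀ y → p y ≡ false
countV≡0⇒none p #p≡0 y = from ≡false⇔≢true λ py → case trans (sym #p≡0) (countV-without p py) of λ ()

countV-partition : ∀ {n} (p q r : Fin n → Bool) → (∀ y → p y ≡ true → q y ≡ false) →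
                   (∀ y → p y ∨ q y ≡ true → r y ≡ true) →
                   countV r ≡ countV p N.+ countV q N.+ countV (λ y → r y ∧ not (p y ∨ q y))
countV-partition {n} p q r p∩q≡∅ p∪q⊆r = countV-via-∑ r (begin
  ∑ₙ r                                                 ≡⟨ ∑-cong (allFin n) split ⟩
  ∑[ y ∈ allFin n ] (𝟙 (p y) + 𝟙 (q y) + 𝟙 (rest y))   ≡⟨ ∑-distrib-+ (allFin n) (λ y → 𝟙 (p y) + 𝟙 (q y)) (𝟙 ∘ rest) ⟩
  ∑[ y ∈ allFin n ] (𝟙 (p y) + 𝟙 (q y)) + ∑ₙ rest      ≡⟨ cong (_+ ∑ₙ rest) (∑-distrib-+ (allFin n) (𝟙 ∘ p) (𝟙 ∘ q)) ⟩
  ∑ₙ p + ∑ₙ q + ∑ₙ rest                               ≡⟨ cong₂ _+_ (cong₂ _+_ (#≡∑ p) (#≡∑ q)) (#≡∑ rest) ⟨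
  ℕ→ℚ (countV p) + ℕ→ℚ (countV q) + ℕ→ℚ (countV rest) ≡⟨ cong (_+ ℕ→ℚ (countV rest)) (ℕ→ℚ-+ (countV p) (countV q)) ⟨
  ℕ→ℚ (countV p N.+ countV q) + ℕ→ℚ (countV rest)     ≡⟨ ℕ→ℚ-+ (countV p N.+ countV q) (countV rest) ⟨
  ℕ→ℚ (countV p N.+ countV q N.+ countV rest)         ∎)
  where
  rest : Fin n → Bool
  rest y = r y ∧ not (p y ∨ q y)
  ∑ₙ : (Fin n → Bool) → ℚ
  ∑ₙ s = ∑[ y ∈ allFin n ] 𝟙 (s y)
  #≡∑ : ∀ s → ℕ→ℚ (countV s) ≡ ∑ₙ s
  #≡∑ s = length-filterᵇ s (allFin n)
  split : ∀ y → 𝟙 (r y) ≡ 𝟙 (p y) + 𝟙 (q y) + 𝟙 (rest y)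
  split y with p y in py | q y in qy
  ... | true  | true  with () ← trans (sym qy) (p∩q≡∅ y py)
  ... | true  | false rewrite p∪q⊆r y (cong (_∨ q y) py) = refl
  ... | false | true  rewrite p∪q⊆r y (trans (cong (_∨ q y) py) qy) = refl
  ... | false | false = trans (cong 𝟙 (sym (BP.∧-identityʳ (r y)))) (sym (QP.+-identityˡ _))

adj-sym : ∀ {n} (G : Graph n) {u v} → adj G u v ≡ true → adj G v u ≡ true
adj-sym G {u} {v} e = trans (Graph.sym G v u) e

adj⇒≢ : ∀ {n} (G : Graph n) {u v} → adj G u v ≡ true → u ≢ v
adj⇒≢ G {u} e refl = contradiction (trans (sym e) (irrefl G u)) λ ()

Independent : ∀ {n} → Graph n → Subset n → Set
Independent G I = ∀ u v → u ∈ˢ I ≡ true → v ∈ˢ I ≡ true → adj G u v ≡ false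

isIndependent-⇔ : ∀ {n} (G : Graph n) I → isIndependent G I ≡ true ⇔ Independent G I
isIndependent-⇔ G I = mk⇔
  (λ e u v → to nand-≡true (to all-allFin (to all-allFin e u) v))
  (λ indep → from all-allFin λ u → from all-allFin λ v → from nand-≡true (indep u v))

inN-⇔ : ∀ {n} (G : Graph n) I y → inN G I y ≡ true ⇔ ∃ λ u → u ∈ˢ I ≡ true × adj G u y ≡ true
inN-⇔ G I y = mk⇔ (map₂ (to ∧-≡true) ∘ to any-allFin) (from any-allFin ∘ map₂ (from ∧-≡true))

inClosedN : ∀ {n} → Graph n → Subset n → Fin n → Bool
inClosedN G I y = (y ∈ˢ I) ∨ inN G I y

lookup-remove : ∀ {n} (I : Subset n) x y → y ∈ˢ remove I x ≡ without (lookup I) x y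
lookup-remove (b ∷ I) F.zero    F.zero    = sym (BP.∧-zeroʳ b)
lookup-remove (b ∷ I) F.zero    (F.suc y) = sym (BP.∧-identityʳ (lookup I y))
lookup-remove (b ∷ I) (F.suc x) F.zero    = sym (BP.∧-identityʳ b)
lookup-remove (b ∷ I) (F.suc x) (F.suc y) =
  trans (lookup-remove I x y) (cong (λ d → lookup I y ∧ not d) (sym (⌊suc≟suc⌋ y x)))

∈-remove-⇔ : ∀ {n} (I : Subset n) x {y} → y ∈ˢ remove I x ≡ true ⇔ (y ∈ˢ I ≡ true × y ≢ x)
∈-remove-⇔ I x {y} = mk⇔ (to without-⇔′ ∘ trans (sym (lookup-remove I x y))) (trans (lookup-remove I x y) ∘ from without-⇔′)
  where
  without-⇔′ : without (lookup I) x y ≡ true ⇔ (y ∈ˢ I ≡ true × y ≢ x)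
  without-⇔′ = without-⇔ (lookup I)

remove-∉ : ∀ {n} (I : Subset n) {x} → x ∈ˢ I ≡ false → remove I x ≡ I
remove-∉ (b ∷ I) {F.zero}  refl = refl
remove-∉ (b ∷ I) {F.suc x} x∉I  = cong (b ∷_) (remove-∉ I x∉I)

remove-independent : ∀ {n} (G : Graph n) I x → Independent G I → Independent G (remove I x)
remove-independent G I x indep u v u∈ v∈ = indep u v (proj₁ (to (∈-remove-⇔ I x) u∈)) (proj₁ (to (∈-remove-⇔ I x) v∈))

card-remove : ∀ {n} (I : Subset n) {x} → x ∈ˢ I ≡ true → card I ≡ N.suc (card (remove I x))
card-remove I {x} x∈I =
  trans (countV-without (lookup I) x∈I) (cong N.suc (countV-cong (λ y → sym (lookup-remove I x y))))

card-true∷ : ∀ {n} (I : Subset n) → card (true ∷ I) ≡ N.suc (card I)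
card-true∷ {n} I = countV-via-∑ (_∈ˢ (true ∷ I)) (begin
  ∑[ v ∈ allFin (N.suc n) ] 𝟙 (v ∈ˢ (true ∷ I))  ≡⟨ ∑-allFin-suc (λ v → 𝟙 (v ∈ˢ (true ∷ I))) ⟩
  1ℚ + ∑[ v ∈ allFin n ] 𝟙 (v ∈ˢ I)              ≡⟨ cong (1ℚ +_) (length-filterᵇ (_∈ˢ I) (allFin n)) ⟨
  1ℚ + ℕ→ℚ (card I)                              ≡⟨ ℕ→ℚ-+ 1 (card I) ⟨
  ℕ→ℚ (N.suc (card I))                           ∎)

card-false∷ : ∀ {n} (I : Subset n) → card (false ∷ I) ≡ card I
card-false∷ {n} I = countV-via-∑ (_∈ˢ (false ∷ I)) (begin
  ∑[ v ∈ allFin (N.suc n) ] 𝟙 (v ∈ˢ (false ∷ I)) ≡⟨ ∑-allFin-suc (λ v → 𝟙 (v ∈ˢ (false ∷ I))) ⟩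
  0ℚ + ∑[ v ∈ allFin n ] 𝟙 (v ∈ˢ I)              ≡⟨ QP.+-identityˡ _ ⟩
  ∑[ v ∈ allFin n ] 𝟙 (v ∈ˢ I)                   ≡⟨ length-filterᵇ (_∈ˢ I) (allFin n) ⟨
  ℕ→ℚ (card I)                                   ∎)

-- The recursion for b

module _ {n} (G : Graph n) {I : Subset n} (indep : Independent G I) where

  independent⇒∉N : ∀ y → y ∈ˢ I ≡ true → inN G I y ≡ false
  independent⇒∉N y y∈I = from ≡false⇔≢true λ y∈N →
    let (u , u∈I , u~y) = to (inN-⇔ G I y) y∈N in contradiction (trans (sym u~y) (indep u y u∈I y∈I)) λ ()

  countV-closedN-partition : ∀ (R : Fin n → Bool) → (∀ y → inClosedN G I y ≡ true → R y ≡ true) →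
                             countV R ≡ card I N.+ cardN G I N.+ countV (λ y → R y ∧ not (inClosedN G I y))
  countV-closedN-partition R = countV-partition (lookup I) (inN G I) R independent⇒∉N

  n≡card+cardN+outside : n ≡ card I N.+ cardN G I N.+ countV (not ∘ inClosedN G I)
  n≡card+cardN+outside = trans (sym countV-all) (countV-closedN-partition (λ _ → true) (λ _ _ → refl))

  a≡outside : a G I ≡ countV (not ∘ inClosedN G I)
  a≡outside = begin
    n N.∸ card I N.∸ cardN G I                ≡⟨ NP.∸-+-assoc n (card I) (cardN G I) ⟩
    n N.∸ s                                   ≡⟨ cong (N._∸ s) n≡card+cardN+outside ⟩
    s N.+ countV (not ∘ inClosedN G I) N.∸ s  ≡⟨ NP.m+n∸m≡n s _ ⟩
    countV (not ∘ inClosedN G I)              ∎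
    where
    s : ℕ
    s = card I N.+ cardN G I

  n∸a≡card+cardN : n N.∸ a G I ≡ card I N.+ cardN G I
  n∸a≡card+cardN = begin
    n N.∸ a G I                       ≡⟨ cong (n N.∸_) a≡outside ⟩
    n N.∸ c                           ≡⟨ cong (N._∸ c) n≡card+cardN+outside ⟩
    card I N.+ cardN G I N.+ c N.∸ c  ≡⟨ NP.m+n∸n≡m (card I N.+ cardN G I) c ⟩
    card I N.+ cardN G I              ∎
    where
    c : ℕ
    c = countV (not ∘ inClosedN G I)

  b-unfold : ∀ {k} → card I ≡ N.suc k →
             b G I ≡ inv (N.suc (k N.+ cardN G I)) * ∑[ x ∈ allFin n ] (𝟙 (x ∈ˢ I) * bAux G k (remove I x))
  b-unfold {k} |I|≡ = begin
    b G I                                                 ≡⟨ cong (λ c → bAux G c I) |I|≡ ⟩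
    inv (n N.∸ a G I) * sumℚ (map (λ x → bAux G k (remove I x)) (filterᵇ (_∈ˢ I) (allFin n)))
      ≡⟨ cong₂ _*_ (cong inv (trans n∸a≡card+cardN (cong (N._+ cardN G I) |I|≡)))
                   (trans (sumℚ-map _ (filterᵇ (_∈ˢ I) (allFin n))) (∑-filterᵇ (_∈ˢ I) (allFin n) _)) ⟩
    inv (N.suc (k N.+ cardN G I)) * ∑[ x ∈ allFin n ] (𝟙 (x ∈ˢ I) * bAux G k (remove I x)) ∎

  b-recurrence-∅ : card I ≡ 0 → ∑[ x ∈ allFin n ] (𝟙 (x ∈ˢ I) * b G (remove I x)) ≡ ℕ→ℚ (card I N.+ cardN G I) * b G I
  b-recurrence-∅ |I|≡0 = begin
    ∑[ x ∈ allFin n ] (𝟙 (x ∈ˢ I) * b G (remove I x))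
      ≡⟨ ∑-cong (allFin n) (λ x → trans (cong (λ β → 𝟙 β * b G (remove I x)) (I-empty x)) (QP.*-zeroˡ (b G (remove I x)))) ⟩
    ∑[ x ∈ allFin n ] 0ℚ                      ≡⟨ ∑-zero (allFin n) ⟩
    0ℚ                                        ≡⟨ QP.*-zeroˡ (b G I) ⟨
    0ℚ * b G I                                ≡⟨ cong (λ c → ℕ→ℚ c * b G I) (cong₂ N._+_ |I|≡0 N-empty) ⟨
    ℕ→ℚ (card I N.+ cardN G I) * b G I        ∎
    where
    I-empty : ∀ x → x ∈ˢ I ≡ false
    I-empty = countV≡0⇒none (lookup I) |I|≡0
    N-empty : cardN G I ≡ 0
    N-empty = countV-none λ y → from ≡false⇔≢true λ y∈N →
      let (u , u∈I , _) = to (inN-⇔ G I y) y∈N in contradiction (trans (sym u∈I) (I-empty u)) λ ()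

  b-recurrence-suc : ∀ {k} → card I ≡ N.suc k →
                     ∑[ x ∈ allFin n ] (𝟙 (x ∈ˢ I) * b G (remove I x)) ≡ ℕ→ℚ (card I N.+ cardN G I) * b G I
  b-recurrence-suc {k} |I|≡ = begin
    ∑[ x ∈ allFin n ] (𝟙 (x ∈ˢ I) * b G (remove I x))  ≡⟨ ∑-cong (allFin n) remove-card ⟩
    S                                                 ≡⟨ QP.*-identityˡ S ⟨
    1ℚ * S                                            ≡⟨ cong (_* S) (inv-inverseˡ (k N.+ cardN G I)) ⟨
    (inv s * ℕ→ℚ s) * S                               ≡⟨ ℚ*.xy∙z≈y∙xz (inv s) (ℕ→ℚ s) S ⟩
    ℕ→ℚ s * (inv s * S)                               ≡⟨ cong (ℕ→ℚ s *_) (b-unfold |I|≡) ⟨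
    ℕ→ℚ s * b G I                                     ≡⟨ cong (λ c → ℕ→ℚ (c N.+ cardN G I) * b G I) |I|≡ ⟨
    ℕ→ℚ (card I N.+ cardN G I) * b G I                ∎
    where
    s : ℕ
    s = N.suc (k N.+ cardN G I)
    S : ℚ
    S = ∑[ x ∈ allFin n ] (𝟙 (x ∈ˢ I) * bAux G k (remove I x))
    remove-card : ∀ x → 𝟙 (x ∈ˢ I) * b G (remove I x) ≡ 𝟙 (x ∈ˢ I) * bAux G k (remove I x)
    remove-card x with x ∈ˢ I in x∈I
    ... | true  = cong (λ c → 1ℚ * bAux G c (remove I x)) (NP.suc-injective (trans (sym (card-remove I x∈I)) |I|≡))
    ... | false = trans (QP.*-zeroˡ (b G (remove I x))) (sym (QP.*-zeroˡ (bAux G k (remove I x))))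

  b-recurrence : ∑[ x ∈ allFin n ] (𝟙 (x ∈ˢ I) * b G (remove I x)) ≡ ℕ→ℚ (card I N.+ cardN G I) * b G I
  b-recurrence = by-card (card I) refl
    where
    by-card : ∀ c → card I ≡ c → ∑[ x ∈ allFin n ] (𝟙 (x ∈ˢ I) * b G (remove I x)) ≡ ℕ→ℚ (card I N.+ cardN G I) * b G I
    by-card N.zero    = b-recurrence-∅
    by-card (N.suc _) = b-recurrence-suc

  ∑-b-remove : ∀ (R : Fin n → Bool) → (∀ y → inClosedN G I y ≡ true → R y ≡ true) →
               ∑[ x ∈ allFin n ] (𝟙 (R x ∧ not (inN G I x)) * b G (remove I x)) ≡ ℕ→ℚ (countV R) * b G I
  ∑-b-remove R N[I]⊆R = begin
    ∑[ x ∈ allFin n ] (𝟙 (R x ∧ not (inN G I x)) * b G (remove I x))     ≡⟨ ∑-cong (allFin n) split ⟩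
    ∑[ x ∈ allFin n ] (𝟙 (x ∈ˢ I) * b G (remove I x) + 𝟙 (rest x) * b G I)
      ≡⟨ ∑-distrib-+ (allFin n) (λ x → 𝟙 (x ∈ˢ I) * b G (remove I x)) (λ x → 𝟙 (rest x) * b G I) ⟩
    ∑[ x ∈ allFin n ] (𝟙 (x ∈ˢ I) * b G (remove I x)) + ∑[ x ∈ allFin n ] (𝟙 (rest x) * b G I)
      ≡⟨ cong₂ _+_ b-recurrence (sym (*-distribʳ-∑ (b G I) (allFin n) (𝟙 ∘ rest))) ⟩
    ℕ→ℚ s * b G I + ∑[ x ∈ allFin n ] 𝟙 (rest x) * b G I
      ≡⟨ cong (λ q → ℕ→ℚ s * b G I + q * b G I) (length-filterᵇ rest (allFin n)) ⟨
    ℕ→ℚ s * b G I + ℕ→ℚ (countV rest) * b G I                          ≡⟨ QP.*-distribʳ-+ (b G I) (ℕ→ℚ s) (ℕ→ℚ (countV rest)) ⟨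
    (ℕ→ℚ s + ℕ→ℚ (countV rest)) * b G I                                ≡⟨ cong (_* b G I) (ℕ→ℚ-+ s (countV rest)) ⟨
    ℕ→ℚ (s N.+ countV rest) * b G I                                    ≡⟨ cong (λ c → ℕ→ℚ c * b G I) (countV-closedN-partition R N[I]⊆R) ⟨
    ℕ→ℚ (countV R) * b G I                                             ∎
    where
    s : ℕ
    s = card I N.+ cardN G I
    rest : Fin n → Bool
    rest y = R y ∧ not (inClosedN G I y)
    split : ∀ x → 𝟙 (R x ∧ not (inN G I x)) * b G (remove I x) ≡ 𝟙 (x ∈ˢ I) * b G (remove I x) + 𝟙 (rest x) * b G I
    split x with x ∈ˢ I in x∈I
    ... | true  rewrite N[I]⊆R x (cong (_∨ inN G I x) x∈I) | independent⇒∉N x x∈I =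
      sym (trans (cong (1ℚ * b G (remove I x) +_) (QP.*-zeroˡ (b G I))) (QP.+-identityʳ _))
    ... | false rewrite remove-∉ I x∈I =
      sym (trans (cong (_+ 𝟙 (R x ∧ not (inN G I x)) * b G I) (QP.*-zeroˡ (b G I))) (QP.+-identityˡ _))

isBijection-⇔ : ∀ {n} (π : Vec (Fin n) n) → isBijection π ≡ true ⇔ Injective _≡_ _≡_ (lookup π)
isBijection-⇔ π = mk⇔
  (λ e {u} {v} πu≡πv → to (⌊⌋-≡true (u ≟ v))
     (to implies-≡true (to all-allFin (to all-allFin e u) v) (from (⌊⌋-≡true (lookup π u ≟ lookup π v)) πu≡πv)))
  (λ inj → from all-allFin λ u → from all-allFin λ v → from implies-≡true λ e →
     from (⌊⌋-≡true (u ≟ v)) (inj (to (⌊⌋-≡true (lookup π u ≟ lookup π v)) e)))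

injective⇒surjective : ∀ {n} (τ : Vec (Fin n) n) → Injective _≡_ _≡_ (lookup τ) → ∀ v → ∃ λ i → lookup τ i ≡ v
injective⇒surjective {N.suc n} τ inj v with FP.any? (λ i → lookup τ i ≟ v)
... | yes hit  = hit
... | no  miss = let (i , j , i<j , eq) = FP.pigeonhole (NP.n<1+n n) (λ i → F.punchOut (avoids i))
                 in contradiction (inj (FP.punchOut-injective (avoids i) (avoids j) eq)) (FP.<⇒≢ i<j)
  where
  avoids : ∀ i → v ≢ lookup τ i
  avoids i v≡τi = miss (i , sym v≡τi)

-- The fallback v is only reached when τ is not injective.
preimage : ∀ {n} → Vec (Fin n) n → Fin n → Fin n
preimage τ v with FP.any? (λ i → lookup τ i ≟ v)
... | yes (i , _) = i
... | no  _       = v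

inverse : ∀ {n} → Vec (Fin n) n → Vec (Fin n) n
inverse τ = V.tabulate (preimage τ)

module _ {n} (τ : Vec (Fin n) n) (inj : Injective _≡_ _≡_ (lookup τ)) where

  lookup-preimage : ∀ v → lookup τ (preimage τ v) ≡ v
  lookup-preimage v with FP.any? (λ i → lookup τ i ≟ v)
  ... | yes (_ , τi≡v) = τi≡v
  ... | no  miss       = contradiction (injective⇒surjective τ inj v) miss

  lookup-inverse : ∀ v → lookup τ (lookup (inverse τ) v) ≡ v
  lookup-inverse v = trans (cong (lookup τ) (VP.lookup∘tabulate (preimage τ) v)) (lookup-preimage v)

  inverse-lookup : ∀ i → lookup (inverse τ) (lookup τ i) ≡ i
  inverse-lookup i = inj (lookup-inverse (lookup τ i))

  inverse-injective : Injective _≡_ _≡_ (lookup (inverse τ))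
  inverse-injective {u} {v} eq = trans (sym (lookup-inverse u)) (trans (cong (lookup τ) eq) (lookup-inverse v))

inverse-involutive : ∀ {n} (τ : Vec (Fin n) n) → Injective _≡_ _≡_ (lookup τ) → inverse (inverse τ) ≡ τ
inverse-involutive τ inj = trans (VP.tabulate-cong preimage≗lookup) (VP.tabulate∘lookup τ)
  where
  preimage≗lookup : ∀ i → preimage (inverse τ) i ≡ lookup τ i
  preimage≗lookup i = inverse-injective τ inj (begin
    lookup (inverse τ) (preimage (inverse τ) i)  ≡⟨ lookup-preimage (inverse τ) (inverse-injective τ inj) i ⟩
    i                                            ≡⟨ inverse-lookup τ inj i ⟨
    lookup (inverse τ) (lookup τ i)              ∎)

∑-linearOrderings-inverse : ∀ n (f : Vec (Fin n) n → ℚ) → ∑ (linearOrderings n) f ≡ ∑ (linearOrderings n) (f ∘ inverse)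
∑-linearOrderings-inverse n = ∑-filterᵇ-involution _≟ⱽ_ (allVecs n n) (∑-allVecs-δ n) isBijection inverse
  (λ τ e → from (isBijection-⇔ (inverse τ)) (inverse-injective τ (to (isBijection-⇔ τ) e)))
  (λ τ e → inverse-involutive τ (to (isBijection-⇔ τ) e))

module _ {n m} {x : Fin n} {τ : Vec (Fin n) m} (inj : Injective _≡_ _≡_ (lookup (x ∷ τ))) where

  injective-tail : Injective _≡_ _≡_ (lookup τ)
  injective-tail eq = FP.suc-injective (inj eq)

  injective-head : ∀ j → lookup τ j ≢ x
  injective-head j eq with inj {F.suc j} {F.zero} eq
  ... | ()

injective-∷ : ∀ {n m} {x : Fin n} {τ : Vec (Fin n) m} → (∀ j → lookup τ j ≢ x) → Injective _≡_ _≡_ (lookup τ) →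
              Injective _≡_ _≡_ (lookup (x ∷ τ))
injective-∷ fresh inj {F.zero}  {F.zero}  eq = refl
injective-∷ fresh inj {F.zero}  {F.suc j} eq = contradiction (sym eq) (fresh j)
injective-∷ fresh inj {F.suc i} {F.zero}  eq = contradiction eq (fresh i)
injective-∷ fresh inj {F.suc i} {F.suc j} eq = cong F.suc (inj eq)

position : ∀ {n m} → Vec (Fin n) m → Fin n → ℕ
position []      v = 0
position (x ∷ τ) v = if ⌊ x ≟ v ⌋ then 0 else N.suc (position τ v)

position-here : ∀ {n m} (x : Fin n) (τ : Vec (Fin n) m) → position (x ∷ τ) x ≡ 0
position-here x τ rewrite from (⌊⌋-≡true (x ≟ x)) refl = refl

position-there : ∀ {n m} {x v : Fin n} (τ : Vec (Fin n) m) → x ≢ v → position (x ∷ τ) v ≡ N.suc (position τ v)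
position-there {x = x} {v} τ x≢v rewrite ⌊⌋-≡false (x ≟ v) x≢v = refl

position≡0⇒here : ∀ {n m} {x v : Fin n} (τ : Vec (Fin n) m) → position (x ∷ τ) v ≡ 0 → x ≡ v
position≡0⇒here {x = x} {v} τ eq with x ≟ v
... | yes x≡v = x≡v

position-lookup : ∀ {n m} (τ : Vec (Fin n) m) → Injective _≡_ _≡_ (lookup τ) → ∀ i → position τ (lookup τ i) ≡ toℕ i
position-lookup (x ∷ τ) inj F.zero    = position-here x τ
position-lookup (x ∷ τ) inj (F.suc i) = trans (position-there τ (injective-head {x = x} {τ} inj i ∘ sym))
                                              (cong N.suc (position-lookup τ (injective-tail {x = x} {τ} inj) i))

toℕ-inverse : ∀ {n} (τ : Vec (Fin n) n) → Injective _≡_ _≡_ (lookup τ) → ∀ v → toℕ (lookup (inverse τ) v) ≡ position τ v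
toℕ-inverse τ inj v = trans (sym (position-lookup τ inj _)) (cong (position τ) (lookup-inverse τ inj v))

isDistinctIn : ∀ {n m} → (Fin n → Bool) → Vec (Fin n) m → Bool
isDistinctIn R []      = true
isDistinctIn R (x ∷ τ) = R x ∧ isDistinctIn (without R x) τ

isDistinctIn-⇔ : ∀ {n m} {R : Fin n → Bool} {τ : Vec (Fin n) m} →
                 isDistinctIn R τ ≡ true ⇔ ((∀ i → R (lookup τ i) ≡ true) × Injective _≡_ _≡_ (lookup τ))
isDistinctIn-⇔ {τ = []}        = mk⇔ (λ _ → (λ ()) , λ {i} → case i of λ ()) (λ _ → refl)
isDistinctIn-⇔ {R = R} {x ∷ τ} = mk⇔ forth back
  where
  IH : isDistinctIn (without R x) τ ≡ true ⇔ ((∀ i → without R x (lookup τ i) ≡ true) × Injective _≡_ _≡_ (lookup τ))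
  IH = isDistinctIn-⇔ {R = without R x} {τ}
  forth : isDistinctIn R (x ∷ τ) ≡ true → (∀ i → R (lookup (x ∷ τ) i) ≡ true) × Injective _≡_ _≡_ (lookup (x ∷ τ))
  forth e = let (Rx , rest) = to ∧-≡true e ; (inR′ , inj) = to IH rest in
    (λ { F.zero → Rx ; (F.suc i) → proj₁ (to (without-⇔ R) (inR′ i)) }) ,
    injective-∷ (λ j → proj₂ (to (without-⇔ R) (inR′ j))) inj
  back : (∀ i → R (lookup (x ∷ τ) i) ≡ true) × Injective _≡_ _≡_ (lookup (x ∷ τ)) → isDistinctIn R (x ∷ τ) ≡ true
  back (inR , inj) = from ∧-≡true (inR F.zero , from IH
    ((λ i → from (without-⇔ R) (inR (F.suc i) , injective-head inj i)) , injective-tail inj))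

isBijection≡isDistinctIn : ∀ {n} (π : Vec (Fin n) n) → isBijection π ≡ isDistinctIn (λ _ → true) π
isBijection≡isDistinctIn {n} π = true⇔true⇒≡ (mk⇔
  (λ e → from distinct ((λ _ → refl) , to (isBijection-⇔ π) e))
  (λ e → from (isBijection-⇔ π) (proj₂ (to distinct e))))
  where
  distinct : isDistinctIn (λ _ → true) π ≡ true ⇔ ((Fin n → true ≡ true) × Injective _≡_ _≡_ (lookup π))
  distinct = isDistinctIn-⇔ {R = λ _ → true} {π}

-- Sequences in which a vertex set precedes its neighbours

-- A vertex of I is struck off when it appears, and from then on its neighbours may appear.
precedesNeighboursᵇ : ∀ {n m} → Graph n → Subset n → Vec (Fin n) m → Bool
precedesNeighboursᵇ G I []      = true
precedesNeighboursᵇ G I (x ∷ τ) = not (inN G I x) ∧ precedesNeighboursᵇ G (remove I x) τ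

PrecedesNeighbours : ∀ {n m} → Graph n → Subset n → Vec (Fin n) m → Set
PrecedesNeighbours G I τ = ∀ v u → v ∈ˢ I ≡ true → adj G u v ≡ true → position τ v ≤ position τ u

precedesNeighbours-⇔ : ∀ {n m} (G : Graph n) I (τ : Vec (Fin n) m) →
                       precedesNeighboursᵇ G I τ ≡ true ⇔ PrecedesNeighbours G I τ
precedesNeighbours-⇔ G I []      = mk⇔ (λ _ _ _ _ _ → N.z≤n) (λ _ → refl)
precedesNeighbours-⇔ G I (x ∷ τ) with inN G I x in x∈N
... | true  = mk⇔ (λ ()) λ prec →
  let (w , w∈I , w~x) = to (inN-⇔ G I x) x∈N
  in case subst₂ _≤_ (position-there τ (adj⇒≢ G w~x ∘ sym)) (position-here x τ) (prec w x w∈I (adj-sym G w~x)) of λ ()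
... | false = mk⇔ (grow ∘ to IH) (from IH ∘ shrink)
  where
  IH : precedesNeighboursᵇ G (remove I x) τ ≡ true ⇔ PrecedesNeighbours G (remove I x) τ
  IH = precedesNeighbours-⇔ G (remove I x) τ
  x∉N : ∀ {v u} → v ∈ˢ I ≡ true → adj G u v ≡ true → x ≢ u
  x∉N {v} v∈I u~v refl = contradiction (trans (sym x∈N) (from (inN-⇔ G I x) (v , v∈I , adj-sym G u~v))) λ ()
  grow : PrecedesNeighbours G (remove I x) τ → PrecedesNeighbours G I (x ∷ τ)
  grow prec v u v∈I u~v with x ≟ v
  ... | yes refl = N.z≤n
  ... | no  x≢v  = subst (N.suc (position τ v) ≤_) (sym (position-there τ (x∉N v∈I u~v)))
                     (N.s≤s (prec v u (from (∈-remove-⇔ I x) (v∈I , x≢v ∘ sym)) u~v))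
  shrink : PrecedesNeighbours G I (x ∷ τ) → PrecedesNeighbours G (remove I x) τ
  shrink prec v u v∈I′ u~v =
    let (v∈I , v≢x) = to (∈-remove-⇔ I x) v∈I′
    in NP.≤-pred (subst₂ _≤_ (position-there τ (v≢x ∘ sym)) (position-there τ (x∉N v∈I u~v)) (prec v u v∈I u~v))

closedN-remove⊆without : ∀ {n} (G : Graph n) I (R : Fin n → Bool) {x} → inN G I x ≡ false →
                         (∀ y → inClosedN G I y ≡ true → R y ≡ true) →
                         ∀ y → inClosedN G (remove I x) y ≡ true → without R x y ≡ true
closedN-remove⊆without G I R {x} x∉N N[I]⊆R y e = from (without-⇔ R) (case to ∨-≡true e of λ where
  (inj₁ y∈I∖x) → let (y∈I , y≢x) = to (∈-remove-⇔ I x) y∈I∖x in N[I]⊆R y (from ∨-≡true (inj₁ y∈I)) , y≢x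
  (inj₂ y∈N)   → let (u , u∈I∖x , u~y) = to (inN-⇔ G (remove I x) y) y∈N
                     y∈N[I] = from (inN-⇔ G I y) (u , proj₁ (to (∈-remove-⇔ I x) u∈I∖x) , u~y)
                 in N[I]⊆R y (from ∨-≡true (inj₂ y∈N[I])) , λ { refl → contradiction (trans (sym x∉N) y∈N[I]) λ () })

#arrangements : ∀ {n} → Graph n → (Fin n → Bool) → Subset n → ℕ → ℚ
#arrangements {n} G R I m = ∑[ τ ∈ allVecs m n ] 𝟙 (isDistinctIn R τ ∧ precedesNeighboursᵇ G I τ)

#arrangements-∷ : ∀ {n} (G : Graph n) R I m x →
                  ∑[ τ ∈ allVecs m n ] 𝟙 (isDistinctIn R (x ∷ τ) ∧ precedesNeighboursᵇ G I (x ∷ τ))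
                  ≡ 𝟙 (R x ∧ not (inN G I x)) * #arrangements G (without R x) (remove I x) m
#arrangements-∷ {n} G R I m x = begin
  ∑[ τ ∈ allVecs m n ] 𝟙 ((R x ∧ D τ) ∧ (not (inN G I x) ∧ P τ))
    ≡⟨ ∑-cong (allVecs m n) (λ τ → cong 𝟙 (𝔹∧.interchange (R x) (D τ) _ (P τ))) ⟩
  ∑[ τ ∈ allVecs m n ] 𝟙 ((R x ∧ not (inN G I x)) ∧ (D τ ∧ P τ))
    ≡⟨ ∑-cong (allVecs m n) (λ τ → 𝟙-∧ (R x ∧ not (inN G I x)) _) ⟩
  ∑[ τ ∈ allVecs m n ] (𝟙 (R x ∧ not (inN G I x)) * 𝟙 (D τ ∧ P τ))
    ≡⟨ *-distribˡ-∑ (𝟙 (R x ∧ not (inN G I x))) (allVecs m n) (λ τ → 𝟙 (D τ ∧ P τ)) ⟨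
  𝟙 (R x ∧ not (inN G I x)) * #arrangements G (without R x) (remove I x) m ∎
  where
  D P : Vec (Fin n) m → Bool
  D τ = isDistinctIn (without R x) τ
  P τ = precedesNeighboursᵇ G (remove I x) τ

#arrangements-suc : ∀ {n} (G : Graph n) R I m → #arrangements G R I (N.suc m)
                    ≡ ∑[ x ∈ allFin n ] (𝟙 (R x ∧ not (inN G I x)) * #arrangements G (without R x) (remove I x) m)
#arrangements-suc {n} G R I m = trans (∑-allVecs-suc (λ τ → 𝟙 (isDistinctIn R τ ∧ precedesNeighboursᵇ G I τ)))
                                      (∑-cong (allFin n) (#arrangements-∷ G R I m))

#arrangements≡ : ∀ {n} (G : Graph n) {I} → Independent G I → ∀ m R → (∀ y → inClosedN G I y ≡ true → R y ≡ true) →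
                 countV R ≡ m → #arrangements G R I m ≡ ℕ→ℚ (m !) * b G I
#arrangements≡ G {I} indep N.zero R N[I]⊆R |R|≡0 = sym (cong (λ c → 1ℚ * bAux G c I) (countV-none I-empty))
  where
  I-empty : ∀ y → y ∈ˢ I ≡ false
  I-empty y = from ≡false⇔≢true λ y∈I →
    contradiction (trans (sym (countV≡0⇒none R |R|≡0 y)) (N[I]⊆R y (from ∨-≡true (inj₁ y∈I)))) λ ()
#arrangements≡ {n} G {I} indep (N.suc m) R N[I]⊆R |R|≡ = begin
  #arrangements G R I (N.suc m)                                                    ≡⟨ #arrangements-suc G R I m ⟩
  ∑[ x ∈ allFin n ] (𝟙 (first x) * #arrangements G (without R x) (remove I x) m)   ≡⟨ ∑-cong (allFin n) by-IH ⟩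
  ∑[ x ∈ allFin n ] (𝟙 (first x) * (m! * b G (remove I x)))
    ≡⟨ ∑-cong (allFin n) (λ x → ℚ*.x∙yz≈y∙xz (𝟙 (first x)) m! (b G (remove I x))) ⟩
  ∑[ x ∈ allFin n ] (m! * (𝟙 (first x) * b G (remove I x)))
    ≡⟨ *-distribˡ-∑ m! (allFin n) (λ x → 𝟙 (first x) * b G (remove I x)) ⟨
  m! * ∑[ x ∈ allFin n ] (𝟙 (first x) * b G (remove I x))  ≡⟨ cong (m! *_) (∑-b-remove G indep R N[I]⊆R) ⟩
  m! * (ℕ→ℚ (countV R) * b G I)                           ≡⟨ ℚ*.x∙yz≈yx∙z m! (ℕ→ℚ (countV R)) (b G I) ⟩
  (ℕ→ℚ (countV R) * m!) * b G I                           ≡⟨ cong (_* b G I) (ℕ→ℚ-* (countV R) (m !)) ⟨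
  ℕ→ℚ (countV R N.* m !) * b G I                          ≡⟨ cong (λ c → ℕ→ℚ (c N.* m !) * b G I) |R|≡ ⟩
  ℕ→ℚ (N.suc m !) * b G I                                 ∎
  where
  m! : ℚ
  m! = ℕ→ℚ (m !)
  first : Fin n → Bool
  first x = R x ∧ not (inN G I x)
  by-IH : ∀ x → 𝟙 (first x) * #arrangements G (without R x) (remove I x) m ≡ 𝟙 (first x) * (m! * b G (remove I x))
  by-IH x with first x in x-first
  ... | false = trans (QP.*-zeroˡ (#arrangements G (without R x) (remove I x) m)) (sym (QP.*-zeroˡ (m! * b G (remove I x))))
  ... | true  = let (Rx , x∉N) = to ∧-≡true x-first in cong (1ℚ *_)
    (#arrangements≡ G (remove-independent G I x indep) m (without R x)
       (closedN-remove⊆without G I R (to not-≡true x∉N) N[I]⊆R)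
       (NP.suc-injective (trans (sym (countV-without R Rx)) |R|≡)))

-- Defects of an ordering

isDefect : ∀ {n} → Graph n → Vec (Fin n) n → Fin n → Bool
isDefect {n} G π v =
  not ((toℕ (lookup π v) ≡ᵇ 0) ∨ any (λ u → adj G u v ∧ (toℕ (lookup π u) <ᵇ toℕ (lookup π v))) (allFin n))

isSuccessive≡noDefect : ∀ {n} (G : Graph n) π → isSuccessive G π ≡ all (not ∘ isDefect G π) (allFin n)
isSuccessive≡noDefect G π = cong and (LP.map-cong {g = not ∘ isDefect G π} (λ v → sym (BP.not-involutive _)) (allFin _))

isDefect-⇔ : ∀ {n} (G : Graph n) π v → isDefect G π v ≡ true ⇔
             (toℕ (lookup π v) ≢ 0 × (∀ u → adj G u v ≡ true → toℕ (lookup π v) ≤ toℕ (lookup π u)))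
isDefect-⇔ G π v = mk⇔
  (λ e → let ¬first∨earlier = to ≡false⇔≢true (to not-≡true e) in
    (λ first → ¬first∨earlier (from ∨-≡true (inj₁ (to BP.T-≡ (NP.≡⇒≡ᵇ _ 0 first))))) ,
    (λ u u~v → NP.≮⇒≥ λ earlier → ¬first∨earlier (from ∨-≡true (inj₂
      (from any-allFin (u , from ∧-≡true (u~v , to BP.T-≡ (NP.<⇒<ᵇ earlier))))))))
  (λ (¬first , later) → from not-≡true (from ≡false⇔≢true λ e → case to ∨-≡true e of λ where
    (inj₁ first)   → ¬first (NP.≡ᵇ⇒≡ _ 0 (from BP.T-≡ first))
    (inj₂ earlier) → let (u , u~v∧u<v) = to any-allFin earlier
                         (u~v , u<v) = to (∧-≡true {adj G u v}) u~v∧u<v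
                     in NP.<⇒≱ (NP.<ᵇ⇒< _ _ (from BP.T-≡ u<v)) (later u u~v)))

_⊆ᵇ_ : ∀ {n} → Subset n → (Fin n → Bool) → Bool
I ⊆ᵇ Q = all (λ v → not (v ∈ˢ I) ∨ Q v) (allFin _)

⊆ᵇ-⇔ : ∀ {n} (I : Subset n) Q → I ⊆ᵇ Q ≡ true ⇔ (∀ v → v ∈ˢ I ≡ true → Q v ≡ true)
⊆ᵇ-⇔ I Q = mk⇔ (λ e v → to implies-≡true (to all-allFin e v)) (λ f → from all-allFin λ v → from implies-≡true (f v))

⊆ᵇ-isDefect⇒independent : ∀ {n} (G : Graph n) I (π : Vec (Fin n) n) → Injective _≡_ _≡_ (lookup π) →
                           I ⊆ᵇ isDefect G π ≡ true → Independent G I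
⊆ᵇ-isDefect⇒independent G I π inj e u v u∈I v∈I = from ≡false⇔≢true λ u~v →
  let πv≤πu = proj₂ (to (isDefect-⇔ G π v) (to (⊆ᵇ-⇔ I (isDefect G π)) e v v∈I)) u u~v
      πu≤πv = proj₂ (to (isDefect-⇔ G π u) (to (⊆ᵇ-⇔ I (isDefect G π)) e u u∈I)) v (adj-sym G u~v)
  in adj⇒≢ G u~v (inj (FP.toℕ-injective (NP.≤-antisym πu≤πv πv≤πu)))

⊆ᵇ-isDefect-inverse : ∀ {n} (G : Graph (N.suc n)) I x (τ : Vec (Fin (N.suc n)) n) → Injective _≡_ _≡_ (lookup (x ∷ τ)) →
                      I ⊆ᵇ isDefect G (inverse (x ∷ τ)) ≡ not (x ∈ˢ I) ∧ precedesNeighboursᵇ G I (x ∷ τ)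
⊆ᵇ-isDefect-inverse {n} G I x τ inj = true⇔true⇒≡ (mk⇔
  (λ e → let defect = to (⊆ᵇ-⇔ I (isDefect G π)) e
             x∉I = from ≡false⇔≢true λ x∈I → proj₁ (to (isDefect-⇔ G π x) (defect x x∈I)) (trans (pos x) (position-here x τ))
         in from ∧-≡true (from not-≡true x∉I , from (precedesNeighbours-⇔ G I (x ∷ τ))
              λ v u v∈I u~v → subst₂ _≤_ (pos v) (pos u) (proj₂ (to (isDefect-⇔ G π v) (defect v v∈I)) u u~v)))
  (λ e → let (x∉I , prec) = to ∧-≡true e
         in from (⊆ᵇ-⇔ I (isDefect G π)) λ v v∈I → from (isDefect-⇔ G π v)
              ( (λ first → x∉I⇒≢ (to not-≡true x∉I) v∈I (position≡0⇒here τ (trans (sym (pos v)) first)))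
              , λ u u~v → subst₂ _≤_ (sym (pos v)) (sym (pos u)) (to (precedesNeighbours-⇔ G I (x ∷ τ)) prec v u v∈I u~v))))
  where
  π : Vec (Fin (N.suc n)) (N.suc n)
  π = inverse (x ∷ τ)
  pos : ∀ v → toℕ (lookup π v) ≡ position (x ∷ τ) v
  pos = toℕ-inverse (x ∷ τ) inj
  x∉I⇒≢ : ∀ {v} → x ∈ˢ I ≡ false → v ∈ˢ I ≡ true → x ≢ v
  x∉I⇒≢ x∉I v∈I refl = contradiction (trans (sym x∉I) v∈I) λ ()

isBijection∧⊆ᵇ-isDefect-inverse : ∀ {n} (G : Graph (N.suc n)) I x (τ : Vec (Fin (N.suc n)) n) →
  (isBijection (x ∷ τ) ∧ I ⊆ᵇ isDefect G (inverse (x ∷ τ)))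
  ≡ not (x ∈ˢ I) ∧ (isDistinctIn (λ _ → true) (x ∷ τ) ∧ precedesNeighboursᵇ G I (x ∷ τ))
isBijection∧⊆ᵇ-isDefect-inverse G I x τ with isBijection (x ∷ τ) in bij
... | true  = trans (⊆ᵇ-isDefect-inverse G I x τ (to (isBijection-⇔ (x ∷ τ)) bij))
                    (cong (λ d → not (x ∈ˢ I) ∧ (d ∧ precedesNeighboursᵇ G I (x ∷ τ)))
                          (trans (sym bij) (isBijection≡isDistinctIn (x ∷ τ))))
... | false = sym (trans (cong (λ d → not (x ∈ˢ I) ∧ (d ∧ precedesNeighboursᵇ G I (x ∷ τ)))
                               (trans (sym (isBijection≡isDistinctIn (x ∷ τ))) bij))
                         (BP.∧-zeroʳ (not (x ∈ˢ I))))

#defective : ∀ {n} → Graph n → Subset n → ℚ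
#defective {n} G I = ∑[ π ∈ linearOrderings n ] 𝟙 (I ⊆ᵇ isDefect G π)

#defective-dependent : ∀ {n} (G : Graph n) I → isIndependent G I ≡ false → #defective G I ≡ 0ℚ
#defective-dependent {n} G I dependent = begin
  #defective G I                                                    ≡⟨ ∑-filterᵇ isBijection (allVecs n n) _ ⟩
  ∑[ π ∈ allVecs n n ] (𝟙 (isBijection π) * 𝟙 (I ⊆ᵇ isDefect G π))  ≡⟨ ∑-cong (allVecs n n) vanish ⟩
  ∑[ π ∈ allVecs n n ] 0ℚ                                           ≡⟨ ∑-zero (allVecs n n) ⟩
  0ℚ                                                                ∎
  where
  vanish : ∀ π → 𝟙 (isBijection π) * 𝟙 (I ⊆ᵇ isDefect G π) ≡ 0ℚ
  vanish π with isBijection π in bij | I ⊆ᵇ isDefect G π in I⊆defects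
  ... | false | I⊆? = QP.*-zeroˡ (𝟙 I⊆?)
  ... | true  | false = QP.*-zeroʳ 1ℚ
  ... | true  | true  = contradiction (trans (sym dependent) (from (isIndependent-⇔ G I)
                          (⊆ᵇ-isDefect⇒independent G I π (to (isBijection-⇔ π) bij) I⊆defects))) λ ()

#defective-starting-with : ∀ {n} (G : Graph (N.suc n)) {I} → Independent G I → ∀ x →
  ∑[ τ ∈ allVecs n (N.suc n) ] (𝟙 (isBijection (x ∷ τ)) * 𝟙 (I ⊆ᵇ isDefect G (inverse (x ∷ τ))))
  ≡ 𝟙 (not (inClosedN G I x)) * (ℕ→ℚ (n !) * b G I)
#defective-starting-with {n} G {I} indep x = begin
  ∑[ τ ∈ allVecs n (N.suc n) ] (𝟙 (isBijection (x ∷ τ)) * 𝟙 (I ⊆ᵇ isDefect G (inverse (x ∷ τ))))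
    ≡⟨ ∑-cong (allVecs n (N.suc n)) (λ τ → trans (sym (𝟙-∧ (isBijection (x ∷ τ)) _))
         (trans (cong 𝟙 (isBijection∧⊆ᵇ-isDefect-inverse G I x τ)) (𝟙-∧ (not (x ∈ˢ I)) _))) ⟩
  ∑[ τ ∈ allVecs n (N.suc n) ] (𝟙 (not (x ∈ˢ I)) * 𝟙 (distinct∧precedes τ))
    ≡⟨ *-distribˡ-∑ (𝟙 (not (x ∈ˢ I))) (allVecs n (N.suc n)) (𝟙 ∘ distinct∧precedes) ⟨
  𝟙 (not (x ∈ˢ I)) * ∑[ τ ∈ allVecs n (N.suc n) ] 𝟙 (distinct∧precedes τ)
    ≡⟨ cong (𝟙 (not (x ∈ˢ I)) *_) (#arrangements-∷ G (λ _ → true) I n x) ⟩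
  𝟙 (not (x ∈ˢ I)) * (𝟙 (not (inN G I x)) * #rest)          ≡⟨ outside-closedN ⟩
  𝟙 (not (inClosedN G I x)) * (ℕ→ℚ (n !) * b G I)          ∎
  where
  distinct∧precedes : Vec (Fin (N.suc n)) n → Bool
  distinct∧precedes τ = isDistinctIn (λ _ → true) (x ∷ τ) ∧ precedesNeighboursᵇ G I (x ∷ τ)
  #rest : ℚ
  #rest = #arrangements G (without (λ _ → true) x) (remove I x) n
  outside-closedN : 𝟙 (not (x ∈ˢ I)) * (𝟙 (not (inN G I x)) * #rest) ≡ 𝟙 (not (inClosedN G I x)) * (ℕ→ℚ (n !) * b G I)
  outside-closedN with x ∈ˢ I in x∈I | inN G I x in x∈N
  ... | true  | x∈N? = trans (QP.*-zeroˡ (𝟙 (not x∈N?) * #rest)) (sym (QP.*-zeroˡ (ℕ→ℚ (n !) * b G I)))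
  ... | false | true = trans (QP.*-identityˡ (0ℚ * #rest)) (trans (QP.*-zeroˡ #rest) (sym (QP.*-zeroˡ (ℕ→ℚ (n !) * b G I))))
  ... | false | false rewrite remove-∉ I x∈I = cong (1ℚ *_) (trans (QP.*-identityˡ _)
    (#arrangements≡ G indep n (without (λ _ → true) x)
      (λ y y∈N[I] → from (without-⇔ (λ _ → true)) (refl , λ { refl → case trans (sym y∈N[I]) (cong₂ _∨_ x∈I x∈N) of λ () }))
      (NP.suc-injective (trans (sym (countV-without (λ _ → true) {x} refl)) (countV-all {N.suc n})))))

a*factorial*b≡factorial*w : ∀ {n} (G : Graph (N.suc n)) I → ℕ→ℚ (a G I) * (ℕ→ℚ (n !) * b G I) ≡ ℕ→ℚ (N.suc n !) * w G I
a*factorial*b≡factorial*w {n} G I = sym (begin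
  ℕ→ℚ (N.suc n N.* n !) * ((α * inv (N.suc n)) * β)    ≡⟨ cong (_* ((α * inv (N.suc n)) * β)) (ℕ→ℚ-* (N.suc n) (n !)) ⟩
  (ℕ→ℚ (N.suc n) * μ) * ((α * inv (N.suc n)) * β)
    ≡⟨ solve 5 (λ n+1 n! a 1/n+1 b → (n+1 :* n!) :* ((a :* 1/n+1) :* b) := (1/n+1 :* n+1) :* (a :* (n! :* b))) refl
               (ℕ→ℚ (N.suc n)) μ α (inv (N.suc n)) β ⟩
  (inv (N.suc n) * ℕ→ℚ (N.suc n)) * (α * (μ * β))       ≡⟨ cong (_* (α * (μ * β))) (inv-inverseˡ n) ⟩
  1ℚ * (α * (μ * β))                                    ≡⟨ QP.*-identityˡ _ ⟩
  α * (μ * β)                                           ∎)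
  where
  α μ β : ℚ
  α = ℕ→ℚ (a G I)
  μ = ℕ→ℚ (n !)
  β = b G I

#defective-independent : ∀ {n} (G : Graph (N.suc n)) {I} → Independent G I → #defective G I ≡ ℕ→ℚ (N.suc n !) * w G I
#defective-independent {n} G {I} indep = begin
  ∑[ π ∈ linearOrderings (N.suc n) ] 𝟙 (I ⊆ᵇ isDefect G π)
    ≡⟨ ∑-linearOrderings-inverse (N.suc n) (λ π → 𝟙 (I ⊆ᵇ isDefect G π)) ⟩
  ∑[ τ ∈ linearOrderings (N.suc n) ] 𝟙 (I ⊆ᵇ isDefect G (inverse τ))
    ≡⟨ ∑-filterᵇ isBijection (allVecs (N.suc n) (N.suc n)) (λ τ → 𝟙 (I ⊆ᵇ isDefect G (inverse τ))) ⟩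
  ∑[ τ ∈ allVecs (N.suc n) (N.suc n) ] (𝟙 (isBijection τ) * 𝟙 (I ⊆ᵇ isDefect G (inverse τ)))
    ≡⟨ ∑-allVecs-suc (λ τ → 𝟙 (isBijection τ) * 𝟙 (I ⊆ᵇ isDefect G (inverse τ))) ⟩
  ∑[ x ∈ allFin (N.suc n) ] ∑[ τ ∈ allVecs n (N.suc n) ] (𝟙 (isBijection (x ∷ τ)) * 𝟙 (I ⊆ᵇ isDefect G (inverse (x ∷ τ))))
    ≡⟨ ∑-cong (allFin (N.suc n)) (#defective-starting-with G {I} indep) ⟩
  ∑[ x ∈ allFin (N.suc n) ] (𝟙 (not (inClosedN G I x)) * (ℕ→ℚ (n !) * b G I))
    ≡⟨ *-distribʳ-∑ (ℕ→ℚ (n !) * b G I) (allFin (N.suc n)) (𝟙 ∘ not ∘ inClosedN G I) ⟨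
  ∑[ x ∈ allFin (N.suc n) ] 𝟙 (not (inClosedN G I x)) * (ℕ→ℚ (n !) * b G I)
    ≡⟨ cong (_* (ℕ→ℚ (n !) * b G I)) (trans (sym (length-filterᵇ (not ∘ inClosedN G I) (allFin (N.suc n))))
                                            (cong ℕ→ℚ (sym (a≡outside G {I} indep)))) ⟩
  ℕ→ℚ (a G I) * (ℕ→ℚ (n !) * b G I)                ≡⟨ a*factorial*b≡factorial*w G I ⟩
  ℕ→ℚ (N.suc n !) * w G I                          ∎

#defective≡ : ∀ {n} (G : Graph (N.suc n)) I → #defective G I ≡ 𝟙 (isIndependent G I) * (ℕ→ℚ (N.suc n !) * w G I)
#defective≡ {n} G I = by-independence (isIndependent G I) refl
  where
  by-independence : ∀ β → isIndependent G I ≡ β → #defective G I ≡ 𝟙 β * (ℕ→ℚ (N.suc n !) * w G I)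
  by-independence true  independent = trans (#defective-independent G {I} (to (isIndependent-⇔ G I) independent))
                                            (sym (QP.*-identityˡ (ℕ→ℚ (N.suc n !) * w G I)))
  by-independence false dependent   = trans (#defective-dependent G I dependent) (sym (QP.*-zeroˡ (ℕ→ℚ (N.suc n !) * w G I)))

-- Inclusion–exclusion over subsets

inclusion–exclusion : ∀ n (Q : Fin n → Bool) →
                      ∑[ I ∈ allSubsets n ] (negOnePow (card I) * 𝟙 (I ⊆ᵇ Q)) ≡ 𝟙 (all (not ∘ Q) (allFin n))
inclusion–exclusion N.zero    Q = refl
inclusion–exclusion (N.suc n) Q = begin
  ∑ (allSubsets (N.suc n)) term                                  ≡⟨ ∑-concatMap (λ b → map (b ∷_) S) (true ∷ false ∷ []) term ⟩
  ∑ (map (true ∷_) S) term + (∑ (map (false ∷_) S) term + 0ℚ)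
    ≡⟨ cong₂ _+_ (∑-map (true ∷_) S term) (trans (QP.+-identityʳ _) (∑-map (false ∷_) S term)) ⟩
  ∑[ I ∈ S ] term (true ∷ I) + ∑[ I ∈ S ] term (false ∷ I)       ≡⟨ cong₂ _+_ (∑-cong S with-first) (∑-cong S without-first) ⟩
  ∑[ I ∈ S ] (- negOnePow (card I) * 𝟙 (Q F.zero ∧ I ⊆ᵇ Q′)) + X ≡⟨ by-first (Q F.zero) ⟩
  𝟙 (not (Q F.zero) ∧ all (not ∘ Q′) (allFin n))                 ≡⟨ cong 𝟙 (all-allFin-suc (not ∘ Q)) ⟨
  𝟙 (all (not ∘ Q) (allFin (N.suc n)))                           ∎
  where
  S : List (Subset n)
  S = allSubsets n
  Q′ : Fin n → Bool
  Q′ = Q ∘ F.suc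
  term : Subset (N.suc n) → ℚ
  term I = negOnePow (card I) * 𝟙 (I ⊆ᵇ Q)
  X : ℚ
  X = ∑[ I ∈ S ] (negOnePow (card I) * 𝟙 (I ⊆ᵇ Q′))
  with-first : ∀ I → term (true ∷ I) ≡ - negOnePow (card I) * 𝟙 (Q F.zero ∧ I ⊆ᵇ Q′)
  with-first I = cong₂ _*_ (cong negOnePow (card-true∷ I)) (cong 𝟙 (all-allFin-suc (λ v → not (v ∈ˢ (true ∷ I)) ∨ Q v)))
  without-first : ∀ I → term (false ∷ I) ≡ negOnePow (card I) * 𝟙 (I ⊆ᵇ Q′)
  without-first I = cong₂ _*_ (cong negOnePow (card-false∷ I)) (cong 𝟙 (all-allFin-suc (λ v → not (v ∈ˢ (false ∷ I)) ∨ Q v)))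
  by-first : ∀ q → ∑[ I ∈ S ] (- negOnePow (card I) * 𝟙 (q ∧ I ⊆ᵇ Q′)) + X ≡ 𝟙 (not q ∧ all (not ∘ Q′) (allFin n))
  by-first true  = begin
    ∑[ I ∈ S ] (- negOnePow (card I) * 𝟙 (I ⊆ᵇ Q′)) + X
      ≡⟨ cong (_+ X) (∑-cong S (λ I → sym (QP.neg-distribˡ-* (negOnePow (card I)) (𝟙 (I ⊆ᵇ Q′))))) ⟩
    ∑[ I ∈ S ] (- (negOnePow (card I) * 𝟙 (I ⊆ᵇ Q′))) + X
      ≡⟨ cong (_+ X) (neg-distrib-∑ S (λ I → negOnePow (card I) * 𝟙 (I ⊆ᵇ Q′))) ⟨
    - X + X                                               ≡⟨ QP.+-inverseˡ X ⟩
    0ℚ                                                    ∎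
  by-first false = begin
    ∑[ I ∈ S ] (- negOnePow (card I) * 0ℚ) + X
      ≡⟨ cong (_+ X) (trans (∑-cong S (λ I → QP.*-zeroʳ (- negOnePow (card I)))) (∑-zero S)) ⟩
    0ℚ + X                                                ≡⟨ QP.+-identityˡ X ⟩
    X                                                     ≡⟨ inclusion–exclusion n Q′ ⟩
    𝟙 (all (not ∘ Q′) (allFin n))                         ∎

∑-signed-#defective : ∀ {n} (G : Graph (N.suc n)) →
  ∑[ I ∈ allSubsets (N.suc n) ] (negOnePow (card I) * #defective G I) ≡ ℕ→ℚ (N.suc n !) * P-at-minus1 G
∑-signed-#defective {n} G = begin
  ∑[ I ∈ 𝓘 ] (negOnePow (card I) * #defective G I)     ≡⟨ ∑-cong 𝓘 (λ I → cong (negOnePow (card I) *_) (#defective≡ G I)) ⟩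
  ∑[ I ∈ 𝓘 ] (negOnePow (card I) * (𝟙 (isIndependent G I) * (n+1! * w G I)))
    ≡⟨ ∑-cong 𝓘 (λ I → solve 4 (λ s i f w → s :* (i :* (f :* w)) := f :* (i :* (w :* s))) refl
                                 (negOnePow (card I)) (𝟙 (isIndependent G I)) n+1! (w G I)) ⟩
  ∑[ I ∈ 𝓘 ] (n+1! * (𝟙 (isIndependent G I) * (w G I * negOnePow (card I))))
    ≡⟨ *-distribˡ-∑ n+1! 𝓘 _ ⟨
  n+1! * ∑[ I ∈ 𝓘 ] (𝟙 (isIndependent G I) * (w G I * negOnePow (card I)))
    ≡⟨ cong (n+1! *_) (trans (sumℚ-map _ (filterᵇ (isIndependent G) 𝓘)) (∑-filterᵇ (isIndependent G) 𝓘 _)) ⟨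
  n+1! * P-at-minus1 G                                 ∎
  where
  𝓘 : List (Subset (N.suc n))
  𝓘 = allSubsets (N.suc n)
  n+1! : ℚ
  n+1! = ℕ→ℚ (N.suc n !)

proposition5p2 : (n : ℕ) → 1 ≤ n → (G : Graph n) →
    ℕ→ℚ (σ G) ≡ ℕ→ℚ (n !) * P-at-minus1 G
proposition5p2 (N.suc n) _ G = begin
  ℕ→ℚ (σ G)                                                          ≡⟨ length-filterᵇ (isSuccessive G) Π ⟩
  ∑[ π ∈ Π ] 𝟙 (isSuccessive G π)                                    ≡⟨ ∑-cong Π no-defect ⟩
  ∑[ π ∈ Π ] ∑[ I ∈ 𝓘 ] (negOnePow (card I) * 𝟙 (I ⊆ᵇ isDefect G π)) ≡⟨ ∑-comm Π 𝓘 _ ⟩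
  ∑[ I ∈ 𝓘 ] ∑[ π ∈ Π ] (negOnePow (card I) * 𝟙 (I ⊆ᵇ isDefect G π)) ≡⟨ ∑-cong 𝓘 (λ I → *-distribˡ-∑ (negOnePow (card I)) Π _) ⟨
  ∑[ I ∈ 𝓘 ] (negOnePow (card I) * #defective G I)                   ≡⟨ ∑-signed-#defective G ⟩
  ℕ→ℚ (N.suc n !) * P-at-minus1 G                                    ∎
  where
  Π : List (Vec (Fin (N.suc n)) (N.suc n))
  Π = linearOrderings (N.suc n)
  𝓘 : List (Subset (N.suc n))
  𝓘 = allSubsets (N.suc n)
  no-defect : ∀ π → 𝟙 (isSuccessive G π) ≡ ∑[ I ∈ 𝓘 ] (negOnePow (card I) * 𝟙 (I ⊆ᵇ isDefect G π))
  no-defect π = trans (cong 𝟙 (isSuccessive≡noDefect G π)) (sym (inclusion–exclusion (N.suc n) (isDefect G π)))
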